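{- For every $k\in\mathbb N$, $P(D^{\otimes k})=\ell^\infty(\mathbb N^k)$, where $D=(\mathbb N,\ell^\infty(\mathbb N))$ and the web of $D^{\otimes k}$ is identified with $\mathbb N^k$.
   Context: PCM: a nonempty set with a partial sum on countably indexed families ("summable" families) satisfying (Unary) singletons $(x)$ are summable with sum $x$, and (WPA) for summable $(x_a)_{a\in A}$ and a countable partition $\{A_i\}_{i\in I}$ of $A$ (parts possibly empty), each $(x_a)_{a\in A_i}$ is summable and $(\sum_{a\in A_i}x_a)_i$ is summable with sum $\sum_{a\in A}x_a$; strong if also (PA): if each $(x_a)_{a\in A_i}$ and $(\sum_{a\in A_i}x_a)_i$ are summable then $(x_a)_{a\in A}$ is summable. $0$ is the empty sum; $x\le y$ iff $x+z=y$ for some $z$. A PCR $(R,\Sigma,1,\cdot)$ is a PCM with a commutative monoid $(R,1,\cdot)$ such that for summable $(x_a),(y_b)$, $(x_ay_b)_{(a,b)}$ is summable with sum $(\sum x_a)(\sum y_b)$; strong if its PCM is strong. Setting: $R^+$ a strong PCR, $\mathcal B\subseteq R^+$ downward closed. Webs are countable sets. $\langle x,y\rangle=\sum_a x_ay_a$ (partial); $x\perp y$ iff $\langle x,y\rangle$ is defined and in $\mathcal B$; $F^\perp=\{y\mid\forall x\in F, x\perp y\}$. A covering of $(R^+)^W$ is $F$ such that every $a\in W$ has some $x\in F$ with $x_a$ invertible. An $R^+$-space is $X=(|X|,P(X))$ with $P(X)\subseteq(R^+)^{|X|}$, $P(X)^{\perp\perp}=P(X)$, and $P(X)$, $P(X)^\perp$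 coverings. $(x\otimes y)_{a,b}=x_ay_b$, $F\otimes G=\{x\otimes y\mid x\in F,y\in G\}$, $X\otimes Y=(|X|\times|Y|,(P(X)\otimes P(Y))^{\perp\perp})$. For a countable set $A$, $\Delta_A\in(R^+)^A$ is the constant vector $(\Delta_A)_a=1$, and $\ell^\infty(A)=\{\Delta_A\}^{\perp\perp}\subseteq(R^+)^A$. $D^{\otimes k}$ denotes the $k$-fold tensor of $D$ (with $D^{\otimes 0}$ the unit $(\{*\},\{e_*\}^{\perp\perp})$, $(e_*)_*=1$). -}

module Defs where

open import Level using (0ℓ)
open import Data.Nat using (ℕ; zero; suc)
open import Data.Vec using (Vec; []; _∷_)
open import Data.Product using (Σ; ∃; ∃-syntax; _×_; _,_)
open import Data.Bool using (Bool; true; false; if_then_else_)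
open import Data.Empty using (⊥)
open import Function.Bundles using (_↣_)
open import Relation.Binary.PropositionalEquality using (_≡_)
open import Algebra.Structures using (IsCommutativeMonoid)
open import Relation.Unary using (Pred)

Countable : Set → Set
Countable A = A ↣ ℕ

IsSingleton : Set → Set
IsSingleton A = Σ A (λ a₀ → ∀ a → a ≡ a₀)

-- A countable partition {A_i}_{i∈I} of A (parts possibly empty) is a map p : A → I;
-- the part A_i is the fibre of p over i.
Fiber : {A I : Set} → (A → I) → I → Set
Fiber {A} p i = Σ A (λ a → p a ≡ i)

restrict : {A I R : Set} (p : A → I) (i : I) → (A → R) → Fiber p i → R
restrict p i f (a , _) = f a

-- Partially commutative monoid: a partial sum on countably indexed families,
-- given as a functional relation  SumTo f s  ("f is summable with sum s").
record PCM : Set₁ where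
  field
    Carrier : Set
    element : Carrier
    SumTo : {A : Set} → (A → Carrier) → Carrier → Set
    sum-functional : {A : Set} {f : A → Carrier} {s t : Carrier} → SumTo f s → SumTo f t → s ≡ t
    sum-ext : {A : Set} {f g : A → Carrier} {s : Carrier} → (∀ a → f a ≡ g a) → SumTo f s → SumTo g s
    unary : {A : Set} → IsSingleton A → (x : Carrier) → SumTo (λ (_ : A) → x) x
    wpa : {A I : Set} → Countable A → Countable I → (f : A → Carrier) (s : Carrier) (p : A → I) →
          SumTo f s →
          Σ (I → Carrier) (λ g → (∀ i → SumTo (restrict p i f) (g i)) × SumTo g s)

  Summable : {A : Set} → (A → Carrier) → Set
  Summable f = ∃[ s ] SumTo f s

  IsZero : Carrier → Set
  IsZero z = SumTo (λ (e : ⊥) → Data.Empty.⊥-elim e) z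

  Sum2 : Carrier → Carrier → Carrier → Set
  Sum2 x y s = SumTo (λ (b : Bool) → if b then x else y) s

  _≤_ : Carrier → Carrier → Set
  x ≤ y = ∃[ z ] Sum2 x z y

IsStrongPCM : PCM → Set₁
IsStrongPCM M = {A I : Set} → Countable A → Countable I → (f : A → Carrier) (p : A → I)
                (g : I → Carrier) → (∀ i → SumTo (restrict p i f) (g i)) → Summable g → Summable f
  where open PCM M

record PCR : Set₁ where
  field
    pcm : PCM
  open PCM pcm public
  field
    _·_ : Carrier → Carrier → Carrier
    one : Carrier
    isCommutativeMonoid : IsCommutativeMonoid _≡_ _·_ one
    product : {A B : Set} → Countable A → Countable B →
              {f : A → Carrier} {g : B → Carrier} {s t : Carrier} →
              SumTo f s → SumTo g t →
              SumTo (λ (ab : A × B) → f (Data.Product.proj₁ ab) · g (Data.Product.proj₂ ab)) (s · t)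

IsStrongPCR : PCR → Set₁
IsStrongPCR R = IsStrongPCM (PCR.pcm R)

DownwardClosed : (R : PCR) → Pred (PCR.Carrier R) 0ℓ → Set
DownwardClosed R B = ∀ x y → x ≤ y → B y → B x
  where open PCR R

module Spaces (R : PCR) (B : Pred (PCR.Carrier R) 0ℓ) where
  open PCR R

  Orth : {W : Set} → (W → Carrier) → (W → Carrier) → Set
  Orth x y = ∃[ r ] (SumTo (λ a → x a · y a) r × B r)

  _^⊥ : {W : Set} → Pred (W → Carrier) 0ℓ → Pred (W → Carrier) 0ℓ
  (F ^⊥) y = ∀ x → F x → Orth x y

  IsΔ : {A : Set} → Pred (A → Carrier) 0ℓ
  IsΔ x = ∀ a → x a ≡ one

  ℓ∞ : (A : Set) → Pred (A → Carrier) 0ℓ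
  ℓ∞ A = (IsΔ ^⊥) ^⊥

  PD : Pred (ℕ → Carrier) 0ℓ
  PD = ℓ∞ ℕ

  -- F ⊗ G, with the web ℕ × ℕ^k identified with ℕ^(k+1) via (n , v) ↦ n ∷ v
  Tensor : {k : ℕ} → Pred (ℕ → Carrier) 0ℓ → Pred (Vec ℕ k → Carrier) 0ℓ →
           Pred (Vec ℕ (suc k) → Carrier) 0ℓ
  Tensor F G z = ∃[ x ] ∃[ y ] (F x × G y × (∀ n v → z (n ∷ v) ≡ x n · y v))

  -- P(D^{⊗k}) on the web ℕ^k:
  --   D^{⊗0} = unit ({*}, {e_*}^⊥⊥) with {*} = Vec ℕ 0,
  --   D^{⊗(k+1)} = D ⊗ D^{⊗k},  P = (P(D) ⊗ P(D^{⊗k}))^⊥⊥.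
  IsUnitVec : Pred (Vec ℕ 0 → Carrier) 0ℓ
  IsUnitVec x = x [] ≡ one

  PDk : (k : ℕ) → Pred (Vec ℕ k → Carrier) 0ℓ
  PDk zero = (IsUnitVec ^⊥) ^⊥
  PDk (suc k) = (Tensor PD (PDk k) ^⊥) ^⊥

{-# OPTIONS --safe #-}
module Submission where

-- ℓ∞(W) = {Δ}^⊥⊥, and {Δ}^⊥ consists of the families whose sum exists and lies in 𝓑.
-- The key fact is that multiplying such a family y on W by x ∘ p, for x ∈ ℓ∞(I) and
-- p : W → I, stays in {Δ}^⊥: summing y over the fibres of p gives u ∈ {Δ}^⊥, so
-- ⟨x,u⟩ ∈ 𝓑, and by (PA) the fibrewise sums x_i u_i reassemble into Σ_w x_{p w} y_w.
-- Along the two projections of ℕ × ℕ^k this gives {Δ}^⊥ ⊆ (P(D) ⊗ ℓ∞(ℕ^k))^⊥, while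
-- Δ = Δ ⊗ Δ gives the converse; induction on k concludes.

open import Defs
open import Level using (0ℓ)
open import Data.Nat using (ℕ; zero; suc; _*_)
open import Data.Nat.Properties using (*-cancelˡ-≡; even≢odd; suc-injective; eq?)
open import Data.Vec using (Vec; []; _∷_; head; tail; uncons)
open import Data.Product using (∃-syntax; _×_; _,_; proj₁; proj₂; map₁; uncurry)
open import Data.Product.Function.NonDependent.Propositional using (_×-↣_)
open import Data.Unit using (⊤; tt)
open import Data.Empty using (⊥-elim)
open import Function using (_∘_; const)
open import Function.Bundles using (_↣_; mk↣; Injection)
open import Function.Construct.Composition using (_↣-∘_)
open import Function.Construct.Identity using (↣-id)
open import Function.Definitions using (Injective)
open import Relation.Binary.PropositionalEquality
open import Relation.Unary using (Pred; _⊆_; _≐_)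
open import Algebra.Structures using (IsCommutativeMonoid)
open import Axiom.UniquenessOfIdentityProofs using (module Decidable⇒UIP)

private
  variable
    A C I W : Set

-- pair m n = 2^m (2n + 1) − 1
pair : ℕ → ℕ → ℕ
pair zero    n = 2 * n
pair (suc m) n = suc (2 * pair m n)

pair-injective : Injective _≡_ _≡_ (uncurry pair)
pair-injective {zero  , n} {zero   , n′} e = cong (zero ,_) (*-cancelˡ-≡ n n′ 2 e)
pair-injective {zero  , n} {suc m′ , n′} e = ⊥-elim (even≢odd n (pair m′ n′) e)
pair-injective {suc m , n} {zero   , n′} e = ⊥-elim (even≢odd n′ (pair m n) (sym e))
pair-injective {suc m , n} {suc m′ , n′} e =
  cong (map₁ suc) (pair-injective (*-cancelˡ-≡ (pair m n) (pair m′ n′) 2 (suc-injective e)))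

countable-ℕ : Countable ℕ
countable-ℕ = ↣-id ℕ

countable-⊤ : Countable ⊤
countable-⊤ = mk↣ {to = const 0} (λ _ → refl)

countable-× : Countable A → Countable C → Countable (A × C)
countable-× cA cC = mk↣ pair-injective ↣-∘ (cA ×-↣ cC)

uncons-injection : ∀ {k} → Vec A (suc k) ↣ (A × Vec A k)
uncons-injection = mk↣ {to = uncons} λ { {_ ∷ _} {_ ∷ _} refl → refl }

countable-Vec : Countable A → ∀ k → Countable (Vec A k)
countable-Vec cA zero    = mk↣ {to = const 0} λ { {[]} {[]} _ → refl }
countable-Vec cA (suc k) = countable-× cA (countable-Vec cA k) ↣-∘ uncons-injection

countable-Fiber : Countable W → Countable I → (p : W → I) (i : I) → Countable (Fiber p i)
countable-Fiber cW cI p i = mk↣ {to = Injection.to cW ∘ proj₁} injective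
  where
  open Decidable⇒UIP (eq? cI) using (≡-irrelevant)
  injective : Injective _≡_ _≡_ (Injection.to cW ∘ proj₁)
  injective {w , q} {w′ , q′} e with Injection.injective cW e
  ... | refl = cong (w ,_) (≡-irrelevant q q′)

module _ (R : PCR) where
  open PCR R
  open IsCommutativeMonoid isCommutativeMonoid using (assoc; comm; identityˡ)

  sum-reindex : Countable A → Countable C → (π : A → C) → (∀ c → IsSingleton (Fiber π c)) →
                {h : C → Carrier} {s : Carrier} → SumTo (h ∘ π) s → SumTo h s
  sum-reindex cA cC π singleton {h} {s} Σhπ≡s with wpa cA cC (h ∘ π) s π Σhπ≡s
  ... | g , Σfibre≡g , Σg≡s = sum-ext g≗h Σg≡s
    where
    g≗h : ∀ c → g c ≡ h c
    g≗h c = sum-functional (Σfibre≡g c)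
      (sum-ext (λ { (a , πa≡c) → cong h (sym πa≡c) }) (unary (singleton c) (h c)))

  sum-scaleˡ : Countable A → (c : Carrier) {g : A → Carrier} {t : Carrier} →
               SumTo g t → SumTo (λ a → c · g a) (c · t)
  sum-scaleˡ cA c Σg≡t =
    sum-reindex (countable-× countable-⊤ cA) cA proj₂ proj₂-singleton
      (product countable-⊤ cA (unary (tt , λ _ → refl) c) Σg≡t)
    where
    proj₂-singleton : ∀ a → IsSingleton (Fiber {⊤ × _} proj₂ a)
    proj₂-singleton a = ((tt , a) , refl) , λ { ((tt , _) , refl) → refl }

  sum-by-fibres : IsStrongPCR R → Countable A → Countable I → (p : A → I)
                  {f : A → Carrier} {g : I → Carrier} {t : Carrier} →
                  (∀ i → SumTo (restrict p i f) (g i)) → SumTo g t → SumTo f t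
  sum-by-fibres strong cA cI p {f} {g} {t} Σfibre≡g Σg≡t with strong cA cI f p g Σfibre≡g (_ , Σg≡t)
  ... | s , Σf≡s with wpa cA cI f s p Σf≡s
  ... | g′ , Σfibre≡g′ , Σg′≡s = subst (SumTo f) s≡t Σf≡s
    where
    g′≗g : ∀ i → g′ i ≡ g i
    g′≗g i = sum-functional (Σfibre≡g′ i) (Σfibre≡g i)
    s≡t : s ≡ t
    s≡t = sum-functional (sum-ext g′≗g Σg′≡s) Σg≡t

  module _ (B : Pred Carrier 0ℓ) where
    open Spaces R B

    BoundedSum : Pred (W → Carrier) 0ℓ
    BoundedSum y = ∃[ r ] (SumTo y r × B r)

    boundedSum-ext : {f g : W → Carrier} → (∀ w → f w ≡ g w) → BoundedSum f → BoundedSum g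
    boundedSum-ext f≗g (r , Σf≡r , r∈B) = r , sum-ext f≗g Σf≡r , r∈B

    Δ⊥⇒boundedSum : (IsΔ ^⊥) ⊆ BoundedSum {W}
    Δ⊥⇒boundedSum y∈Δ⊥ = boundedSum-ext (λ w → identityˡ _) (y∈Δ⊥ (const one) (λ _ → refl))

    boundedSum⇒Δ⊥ : BoundedSum ⊆ (IsΔ {W} ^⊥)
    boundedSum⇒Δ⊥ {x = y} y-bounded d d≗1 =
      boundedSum-ext (λ w → sym (trans (cong (_· y w) (d≗1 w)) (identityˡ (y w)))) y-bounded

    orth-sym : {x y : W → Carrier} → Orth x y → Orth y x
    orth-sym = boundedSum-ext (λ w → comm _ _)

    ^⊥-antitone : {F G : Pred (W → Carrier) 0ℓ} → F ⊆ G → G ^⊥ ⊆ F ^⊥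
    ^⊥-antitone F⊆G y∈G⊥ x x∈F = y∈G⊥ x (F⊆G x∈F)

    ^⊥-cong : {F G : Pred (W → Carrier) 0ℓ} → F ≐ G → F ^⊥ ≐ G ^⊥
    ^⊥-cong (F⊆G , G⊆F) = ^⊥-antitone G⊆F , ^⊥-antitone F⊆G

    Δ∈ℓ∞ : ℓ∞ W (const one)
    Δ∈ℓ∞ y y∈Δ⊥ = orth-sym (y∈Δ⊥ (const one) (λ _ → refl))

    ℓ∞-mul-boundedSum : IsStrongPCR R → Countable W → Countable I → (p : W → I)
                        {x : I → Carrier} {y : W → Carrier} →
                        ℓ∞ I x → BoundedSum y → BoundedSum (λ w → x (p w) · y w)
    ℓ∞-mul-boundedSum strong cW cI p {x} {y} x∈ℓ∞ (s , Σy≡s , s∈B)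
      with wpa cW cI y s p Σy≡s
    ... | u , Σfibre≡u , Σu≡s with orth-sym (x∈ℓ∞ u (boundedSum⇒Δ⊥ (s , Σu≡s , s∈B)))
    ... | r , Σxu≡r , r∈B = r , sum-by-fibres strong cW cI p Σfibre≡xu Σxu≡r , r∈B
      where
      Σfibre≡xu : ∀ i → SumTo (restrict p i (λ w → x (p w) · y w)) (x i · u i)
      Σfibre≡xu i = sum-ext (λ { (w , pw≡i) → cong (λ j → x j · y w) (sym pw≡i) })
        (sum-scaleˡ (countable-Fiber cW cI p i) (x i) (Σfibre≡u i))

    module _ {k : ℕ} {G : Pred (Vec ℕ k → Carrier) 0ℓ} where

      IsΔ⊆Tensor : {F : Pred (ℕ → Carrier) 0ℓ} → F (const one) → G (const one) → IsΔ ⊆ Tensor F G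
      IsΔ⊆Tensor Δ∈F Δ∈G z≗1 = const one , const one , Δ∈F , Δ∈G ,
        λ n v → trans (z≗1 (n ∷ v)) (sym (identityˡ one))

      Δ⊥⊆Tensor⊥ : IsStrongPCR R → G ⊆ ℓ∞ (Vec ℕ k) → IsΔ ^⊥ ⊆ Tensor PD G ^⊥
      Δ⊥⊆Tensor⊥ strong G⊆ℓ∞ {y} y∈Δ⊥ z (x , x′ , x∈PD , x′∈G , z≗x⊗x′) =
        boundedSum-ext reassociate
          (mul countable-ℕ head x∈PD (mul (countable-Vec countable-ℕ k) tail (G⊆ℓ∞ x′∈G)
            (Δ⊥⇒boundedSum y∈Δ⊥)))
        where
        mul : Countable I → (p : Vec ℕ (suc k) → I) {x : I → Carrier} {y : Vec ℕ (suc k) → Carrier} →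
              ℓ∞ I x → BoundedSum y → BoundedSum (λ w → x (p w) · y w)
        mul = ℓ∞-mul-boundedSum strong (countable-Vec countable-ℕ (suc k))
        reassociate : ∀ w → x (head w) · (x′ (tail w) · y w) ≡ z w · y w
        reassociate (n ∷ v) = begin
          x n · (x′ v · y (n ∷ v)) ≡⟨ assoc (x n) (x′ v) (y (n ∷ v)) ⟨
          (x n · x′ v) · y (n ∷ v) ≡⟨ cong (_· y (n ∷ v)) (z≗x⊗x′ n v) ⟨
          z (n ∷ v) · y (n ∷ v)    ∎
          where open ≡-Reasoning

      Tensor⊥≐Δ⊥ : IsStrongPCR R → G ≐ ℓ∞ (Vec ℕ k) → Tensor PD G ^⊥ ≐ IsΔ ^⊥
      Tensor⊥≐Δ⊥ strong (G⊆ℓ∞ , ℓ∞⊆G) =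
        ^⊥-antitone (IsΔ⊆Tensor Δ∈ℓ∞ (ℓ∞⊆G Δ∈ℓ∞)) , Δ⊥⊆Tensor⊥ strong G⊆ℓ∞

    IsUnitVec≐IsΔ : IsUnitVec ≐ IsΔ
    IsUnitVec≐IsΔ = (λ { x[]≡1 [] → x[]≡1 }) , (λ x≗1 → x≗1 [])

    PDk≐ℓ∞ : IsStrongPCR R → ∀ k → PDk k ≐ ℓ∞ (Vec ℕ k)
    PDk≐ℓ∞ strong zero    = ^⊥-cong (^⊥-cong IsUnitVec≐IsΔ)
    PDk≐ℓ∞ strong (suc k) = ^⊥-cong (Tensor⊥≐Δ⊥ strong (PDk≐ℓ∞ strong k))

lemma7p2 : (R : PCR) → IsStrongPCR R → (B : Pred (PCR.Carrier R) 0ℓ) → DownwardClosed R B →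
    (k : ℕ) → Spaces.PDk R B k ≐ Spaces.ℓ∞ R B (Vec ℕ k)
lemma7p2 R strong B _ = PDk≐ℓ∞ R B strong
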